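{- Let $v\equiv 0\pmod 4$. Consider a decomposition of the edge set of $K_v$ into $\alpha$ copies of $K_3$, $\beta$ copies of $K_4$ and $\gamma$ copies of $K_5$, and let $c=\alpha+\beta+\gamma$. Then \[ \alpha\le\left\lfloor\frac{20c-v^2-v}{14}\right\rfloor. \]
   Context: A decomposition of the edge set of $K_v$ into cliques means a collection of complete subgraphs of $K_v$ such that every edge of $K_v$ lies in exactly one of them. -}

module Defs where

open import Data.Nat using (ℕ)
open import Data.Fin using (Fin)
open import Data.List using (List; length; filter)
open import Data.List.Membership.Propositional using (_∈_)
open import Data.List.Relation.Unary.All using (All)
open import Data.List.Relation.Unary.Unique.Propositional using (Unique)
open import Data.Product using (_×_; Σ; ∃)
open import Data.Sum using (_⊎_)
open import Relation.Binary.PropositionalEquality using (_≡_; _≢_)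
open import Relation.Nullary.Decidable using (Dec)
open import Data.Nat using (_≟_)

-- A block (clique of K_v) is given by its vertex set: a duplicate-free list of vertices of K_v.
-- A clique decomposition of K_v is a list of blocks (the list allows repeated
-- copies, but the exactly-one condition forbids repeated blocks of size ≥ 2)
-- such that every edge {x,y}, x ≢ y, lies in exactly one block of the list.
record CliqueDecomposition (v : ℕ) : Set where
  field
    blocks   : List (List (Fin v))
    distinct : All Unique blocks
    exactlyOne : ∀ (x y : Fin v) → x ≢ y →
      Σ (Fin (length blocks)) λ i →
        (x ∈ Data.List.lookup blocks i × y ∈ Data.List.lookup blocks i)
        × (∀ j → x ∈ Data.List.lookup blocks j → y ∈ Data.List.lookup blocks j → j ≡ i)

open CliqueDecomposition public

numBlocksOfSize : ∀ {v} → CliqueDecomposition v → ℕ → ℕ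
numBlocksOfSize D k = length (filter (λ B → length B ≟ k) (blocks D))

Only345 : ∀ {v} → CliqueDecomposition v → Set
Only345 D = All (λ B → (length B ≡ 3) ⊎ (length B ≡ 4) ⊎ (length B ≡ 5)) (blocks D)

-- Count, for a point x, the other points on the blocks through x: they are
-- the v − 1 points different from x, each exactly once.  Summed over x this
-- gives Σ |B| (|B| − 1) = v (v − 1), i.e. 6α + 12β + 20γ = v² − v.  Blocks of
-- size 3 and 5 contribute an even number of other points, so when v is even
-- every point lies on an odd number of K₄'s; in particular the K₄'s cover all
-- points and 4β ≥ v.  Hence
--   20c − v² − v = 20(α + β + γ) − (6α + 12β + 20γ) − 2v = 14α + 8β − 2v ≥ 14α.
module Submission where

open import Defs
open import Data.Nat using (ℕ; _%_; _≤_)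
open import Data.List using (length)
open import Relation.Binary.PropositionalEquality using (_≡_)

module Counting where

  open import Data.Bool.Base using (true; false; if_then_else_)
  open import Data.Nat.Base using (zero; suc; _+_; _*_; _∸_; z≤n)
  open import Data.Nat.Properties as ℕ using (+-*-semiring)
  open import Data.Nat.Divisibility
    using (_∣_; divides; _∣0; ∣m∣n⇒∣m+n; ∣m+n∣m⇒∣n; ∣n⇒∣m*n; m∣m*n; ∣1⇒≡1)
  open import Data.Nat.Tactic.RingSolver using (solve-∀)
  open import Data.Fin.Base using (Fin; zero; suc; punchIn)
  open import Data.Fin.Properties using (punchInᵢ≢i; _≟_)
  open import Data.List.Base using (List; []; _∷_; filter; lookup)
  open import Data.List.Membership.Propositional.Properties using (∈-lookup)
  open import Data.List.Relation.Unary.All as All using (All; []; _∷_)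
  open import Data.List.Relation.Unary.All.Properties using (All¬⇒¬Any)
  open import Data.List.Relation.Unary.AllPairs using ([]; _∷_)
  open import Data.List.Relation.Unary.Unique.Propositional using (Unique)
  open import Data.Product.Base using (_×_; _,_)
  open import Data.Sum.Base using (_⊎_; inj₁; inj₂)
  open import Function.Base using (_∘_)
  open import Relation.Nullary using (¬_; Dec; does; yes; no; contradiction)
  open import Relation.Nullary.Decidable using (dec-true; dec-false; _×-dec_)
  open import Relation.Binary.PropositionalEquality
    using (_≢_; refl; sym; trans; cong; cong₂; subst; module ≡-Reasoning)
  open import Algebra.Properties.Semiring.Sum +-*-semiring
    using ( sum; sum-syntax; sum-cong-≗; sum-remove; sum-replicate-zero
          ; ∑-distrib-+; ∑-comm; *-distribˡ-sum; *-distribʳ-sum)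

  𝟙 : ∀ {p} {P : Set p} → Dec P → ℕ
  𝟙 P? = if does P? then 1 else 0

  module _ {p} {P : Set p} where

    𝟙-true : (P? : Dec P) → P → 𝟙 P? ≡ 1
    𝟙-true P? p rewrite dec-true P? p = refl

    𝟙-false : (P? : Dec P) → ¬ P → 𝟙 P? ≡ 0
    𝟙-false P? ¬p rewrite dec-false P? ¬p = refl

    𝟙-idem : (P? : Dec P) → 𝟙 P? * 𝟙 P? ≡ 𝟙 P?
    𝟙-idem P? with does P?
    ... | true  = refl
    ... | false = refl

  𝟙-× : ∀ {p q} {P : Set p} {Q : Set q} (P? : Dec P) (Q? : Dec Q) →
        𝟙 P? * 𝟙 Q? ≡ 𝟙 (P? ×-dec Q?)
  𝟙-× P? Q? with does P? | does Q?
  ... | true  | true  = refl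
  ... | true  | false = refl
  ... | false | _     = refl

  ∑-const : ∀ n c → ∑[ i < n ] c ≡ n * c
  ∑-const zero    c = refl
  ∑-const (suc n) c = cong (c +_) (∑-const n c)

  ∑-ones : ∀ n → ∑[ i < n ] 1 ≡ n
  ∑-ones zero    = refl
  ∑-ones (suc n) = cong suc (∑-ones n)

  ∑-mono-≤ : ∀ {n} {f g : Fin n → ℕ} → (∀ i → f i ≤ g i) → sum f ≤ sum g
  ∑-mono-≤ {zero}  f≤g = z≤n
  ∑-mono-≤ {suc n} f≤g = ℕ.+-mono-≤ (f≤g zero) (∑-mono-≤ (f≤g ∘ suc))

  ∑-∣ : ∀ {d n} {f : Fin n → ℕ} → (∀ i → d ∣ f i) → d ∣ sum f
  ∑-∣ {n = zero}  d∣f = _ ∣0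
  ∑-∣ {n = suc n} d∣f = ∣m∣n⇒∣m+n (d∣f zero) (∑-∣ (d∣f ∘ suc))

  ∑-constExcept : ∀ {n} (f : Fin n → ℕ) (i : Fin n) {c} → (∀ j → j ≢ i → f j ≡ c) →
                  sum f + c ≡ f i + n * c
  ∑-constExcept {suc n} f i {c} f≡c = begin
    sum f + c                      ≡⟨ cong (_+ c) (sum-remove {i = i} f) ⟩
    f i + sum (f ∘ punchIn i) + c  ≡⟨ cong (λ s → f i + s + c) others ⟩
    f i + n * c + c                ≡⟨ regroup (f i) (n * c) c ⟩
    f i + suc n * c                ∎
    where
    open ≡-Reasoning
    others : sum (f ∘ punchIn i) ≡ n * c
    others = trans (sum-cong-≗ (λ j → f≡c _ (punchInᵢ≢i i j))) (∑-const n c)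
    regroup : ∀ a b c → a + b + c ≡ a + (c + b)
    regroup = solve-∀

  ∑-𝟙-unique : ∀ {p n} {P : Fin n → Set p} (P? : ∀ j → Dec (P j)) (i : Fin n) →
               P i → (∀ j → P j → j ≡ i) → ∑[ j < n ] 𝟙 (P? j) ≡ 1
  ∑-𝟙-unique {n = n} P? i Pi unique = begin
    sum (𝟙 ∘ P?)          ≡⟨ ℕ.+-identityʳ _ ⟨
    sum (𝟙 ∘ P?) + 0      ≡⟨ ∑-constExcept (𝟙 ∘ P?) i (λ j j≢i → 𝟙-false (P? j) (j≢i ∘ unique j)) ⟩
    𝟙 (P? i) + n * 0      ≡⟨ cong₂ _+_ (𝟙-true (P? i) Pi) (ℕ.*-zeroʳ n) ⟩
    1                     ∎
    where open ≡-Reasoning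

  module _ {n : ℕ} where
    open import Data.List.Membership.DecPropositional (_≟_ {n}) public using (_∈_; _∉_; _∈?_)

  𝟙-∈-∷ : ∀ {n} {b : Fin n} {B} → b ∉ B → ∀ x → 𝟙 (x ∈? b ∷ B) ≡ 𝟙 (x ≟ b) + 𝟙 (x ∈? B)
  𝟙-∈-∷ {b = b} {B} b∉B x with x ≟ b | x ∈? B
  ... | yes refl | yes b∈B = contradiction b∈B b∉B
  ... | yes refl | no  _   = refl
  ... | no  _    | yes _   = refl
  ... | no  _    | no  _   = refl

  ∑-𝟙-∈ : ∀ {n} {B : List (Fin n)} → Unique B → ∑[ x < n ] 𝟙 (x ∈? B) ≡ length B
  ∑-𝟙-∈ {n} {[]}    []             = sum-replicate-zero n
  ∑-𝟙-∈ {n} {b ∷ B} (b≢B ∷ unique) = begin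
    ∑[ x < n ] 𝟙 (x ∈? b ∷ B)
      ≡⟨ sum-cong-≗ (𝟙-∈-∷ (All¬⇒¬Any b≢B)) ⟩
    ∑[ x < n ] (𝟙 (x ≟ b) + 𝟙 (x ∈? B))
      ≡⟨ ∑-distrib-+ (λ x → 𝟙 (x ≟ b)) (λ x → 𝟙 (x ∈? B)) ⟩
    ∑[ x < n ] 𝟙 (x ≟ b) + ∑[ x < n ] 𝟙 (x ∈? B)
      ≡⟨ cong₂ _+_ (∑-𝟙-unique (_≟ b) b refl (λ _ x≡b → x≡b)) (∑-𝟙-∈ unique) ⟩
    suc (length B)
      ∎
    where open ≡-Reasoning

  module _ {v : ℕ} (D : CliqueDecomposition v) where

    numBlocks : ℕ
    numBlocks = length (blocks D)

    block : Fin numBlocks → List (Fin v)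
    block = lookup (blocks D)

    size : Fin numBlocks → ℕ
    size = length ∘ block

    α β γ : ℕ
    α = numBlocksOfSize D 3
    β = numBlocksOfSize D 4
    γ = numBlocksOfSize D 5

    incidence : Fin v → Fin numBlocks → ℕ
    incidence x i = 𝟙 (x ∈? block i)

    blocksThrough : Fin v → ℕ
    blocksThrough x = ∑[ i < numBlocks ] incidence x i

    blocksThroughBoth : Fin v → Fin v → ℕ
    blocksThroughBoth x y = ∑[ i < numBlocks ] (incidence x i * incidence y i)

    ∑-incidence : ∀ i → ∑[ x < v ] incidence x i ≡ size i
    ∑-incidence i = ∑-𝟙-∈ (All.lookup (distinct D) (∈-lookup i))

    double-count : (g : Fin numBlocks → ℕ) →
                   ∑[ x < v ] ∑[ i < numBlocks ] (incidence x i * g i)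
                     ≡ ∑[ i < numBlocks ] (size i * g i)
    double-count g = trans (∑-comm (λ x i → incidence x i * g i)) (sum-cong-≗ column)
      where
      column : ∀ i → ∑[ x < v ] (incidence x i * g i) ≡ size i * g i
      column i = trans (sym (*-distribʳ-sum (g i) (λ x → incidence x i)))
                       (cong (_* g i) (∑-incidence i))

    ∑-blocksThrough : ∑[ x < v ] blocksThrough x ≡ ∑[ i < numBlocks ] size i
    ∑-blocksThrough = trans (∑-comm incidence) (sum-cong-≗ ∑-incidence)

    blocksThroughBoth-≢ : ∀ {x y} → x ≢ y → blocksThroughBoth x y ≡ 1
    blocksThroughBoth-≢ {x} {y} x≢y with i , x,y∈i , unique ← exactlyOne D x y x≢y = begin
      ∑[ j < numBlocks ] (incidence x j * incidence y j)
        ≡⟨ sum-cong-≗ (λ j → 𝟙-× (x ∈? block j) (y ∈? block j)) ⟩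
      ∑[ j < numBlocks ] 𝟙 (x,y∈? j)
        ≡⟨ ∑-𝟙-unique x,y∈? i x,y∈i (λ j (x∈j , y∈j) → unique j x∈j y∈j) ⟩
      1
        ∎
      where
      open ≡-Reasoning
      x,y∈? : ∀ j → Dec (x ∈ block j × y ∈ block j)
      x,y∈? j = x ∈? block j ×-dec y ∈? block j

    blocksThroughBoth-diag : ∀ x → blocksThroughBoth x x ≡ blocksThrough x
    blocksThroughBoth-diag x = sum-cong-≗ (λ i → 𝟙-idem (x ∈? block i))

    degree : ∀ x → ∑[ i < numBlocks ] (incidence x i * size i) + 1 ≡ blocksThrough x + v
    degree x = begin
      ∑[ i < numBlocks ] (incidence x i * size i) + 1
        ≡⟨ cong (_+ 1) (sum-cong-≗ λ i → cong (incidence x i *_) (∑-incidence i)) ⟨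
      ∑[ i < numBlocks ] (incidence x i * ∑[ y < v ] incidence y i) + 1
        ≡⟨ cong (_+ 1) (sum-cong-≗ λ i → *-distribˡ-sum (incidence x i) (λ y → incidence y i)) ⟩
      ∑[ i < numBlocks ] ∑[ y < v ] (incidence x i * incidence y i) + 1
        ≡⟨ cong (_+ 1) (∑-comm (λ i y → incidence x i * incidence y i)) ⟩
      ∑[ y < v ] blocksThroughBoth x y + 1
        ≡⟨ ∑-constExcept (blocksThroughBoth x) x (λ y y≢x → blocksThroughBoth-≢ (y≢x ∘ sym)) ⟩
      blocksThroughBoth x x + v * 1
        ≡⟨ cong₂ _+_ (blocksThroughBoth-diag x) (ℕ.*-identityʳ v) ⟩
      blocksThrough x + v
        ∎
      where open ≡-Reasoning

    ∑-size² : ∑[ i < numBlocks ] (size i * size i) + v ≡ ∑[ i < numBlocks ] size i + v * v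
    ∑-size² = begin
      ∑[ i < numBlocks ] (size i * size i) + v
        ≡⟨ cong₂ _+_ (double-count size) (∑-ones v) ⟨
      ∑[ x < v ] ∑[ i < numBlocks ] (incidence x i * size i) + ∑[ x < v ] 1
        ≡⟨ ∑-distrib-+ (λ x → ∑[ i < numBlocks ] (incidence x i * size i)) (λ _ → 1) ⟨
      ∑[ x < v ] (∑[ i < numBlocks ] (incidence x i * size i) + 1)
        ≡⟨ sum-cong-≗ degree ⟩
      ∑[ x < v ] (blocksThrough x + v)
        ≡⟨ ∑-distrib-+ blocksThrough (λ _ → v) ⟩
      ∑[ x < v ] blocksThrough x + ∑[ x < v ] v
        ≡⟨ cong₂ _+_ ∑-blocksThrough (∑-const v v) ⟩
      ∑[ i < numBlocks ] size i + v * v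
        ∎
      where open ≡-Reasoning

  Size345 : ℕ → Set
  Size345 n = n ≡ 3 ⊎ n ≡ 4 ⊎ n ≡ 5

  numOfSize : ∀ {A : Set} → ℕ → List (List A) → ℕ
  numOfSize k Bs = length (filter (λ B → length B ℕ.≟ k) Bs)

  ∑-by-size : ∀ {A : Set} (f : ℕ → ℕ) (Bs : List (List A)) → All (Size345 ∘ length) Bs →
              ∑[ i < length Bs ] f (length (lookup Bs i))
                ≡ numOfSize 3 Bs * f 3 + numOfSize 4 Bs * f 4 + numOfSize 5 Bs * f 5
  ∑-by-size f []       []       = refl
  ∑-by-size f (B ∷ Bs) (inj₁ |B|≡3 ∷ ss) rewrite |B|≡3 | ∑-by-size f Bs ss =
    regroup (f 3) (numOfSize 3 Bs * f 3) (numOfSize 4 Bs * f 4) (numOfSize 5 Bs * f 5)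
    where
    regroup : ∀ m p q r → m + (p + q + r) ≡ m + p + q + r
    regroup = solve-∀
  ∑-by-size f (B ∷ Bs) (inj₂ (inj₁ |B|≡4) ∷ ss) rewrite |B|≡4 | ∑-by-size f Bs ss =
    regroup (f 4) (numOfSize 3 Bs * f 3) (numOfSize 4 Bs * f 4) (numOfSize 5 Bs * f 5)
    where
    regroup : ∀ m p q r → m + (p + q + r) ≡ p + (m + q) + r
    regroup = solve-∀
  ∑-by-size f (B ∷ Bs) (inj₂ (inj₂ |B|≡5) ∷ ss) rewrite |B|≡5 | ∑-by-size f Bs ss =
    regroup (f 5) (numOfSize 3 Bs * f 3) (numOfSize 4 Bs * f 4) (numOfSize 5 Bs * f 5)
    where
    regroup : ∀ m p q r → m + (p + q + r) ≡ p + q + (m + r)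
    regroup = solve-∀

  2∣n+[n≡4]+1 : ∀ {n} → Size345 n → 2 ∣ n + 𝟙 (n ℕ.≟ 4) + 1
  2∣n+[n≡4]+1 (inj₁ refl)        = divides 2 refl
  2∣n+[n≡4]+1 (inj₂ (inj₁ refl)) = divides 3 refl
  2∣n+[n≡4]+1 (inj₂ (inj₂ refl)) = divides 3 refl

  module _ {v : ℕ} (D : CliqueDecomposition v) (only345 : Only345 D) where

    isK4 : Fin (numBlocks D) → ℕ
    isK4 i = 𝟙 (size D i ℕ.≟ 4)

    K4sThrough : Fin v → ℕ
    K4sThrough x = ∑[ i < numBlocks D ] (incidence D x i * isK4 i)

    K4sThrough-odd : 2 ∣ v → ∀ x → ¬ 2 ∣ K4sThrough x
    K4sThrough-odd 2∣v x 2∣K = contradiction (∣1⇒≡1 (∣m+n∣m⇒∣n 2∣S+K+r+1 2∣S+K+r)) λ ()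
      where
      inc : Fin (numBlocks D) → ℕ
      inc = incidence D x
      S K r : ℕ
      S = ∑[ i < numBlocks D ] (inc i * size D i)
      K = K4sThrough x
      r = blocksThrough D x

      2∣S+K+r : 2 ∣ S + K + r
      2∣S+K+r = subst (2 ∣_) linearity
        (∑-∣ λ i → ∣n⇒∣m*n (inc i) (2∣n+[n≡4]+1 (All.lookup only345 (∈-lookup i))))
        where
        open ≡-Reasoning
        expand : ∀ a s e → a * (s + e + 1) ≡ a * s + a * e + a
        expand = solve-∀
        linearity : ∑[ i < numBlocks D ] (inc i * (size D i + isK4 i + 1)) ≡ S + K + r
        linearity = begin
          ∑[ i < numBlocks D ] (inc i * (size D i + isK4 i + 1))
            ≡⟨ sum-cong-≗ (λ i → expand (inc i) (size D i) (isK4 i)) ⟩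
          ∑[ i < numBlocks D ] (inc i * size D i + inc i * isK4 i + inc i)
            ≡⟨ ∑-distrib-+ (λ i → inc i * size D i + inc i * isK4 i) inc ⟩
          ∑[ i < numBlocks D ] (inc i * size D i + inc i * isK4 i) + r
            ≡⟨ cong (_+ r) (∑-distrib-+ (λ i → inc i * size D i) (λ i → inc i * isK4 i)) ⟩
          S + K + r
            ∎

      2∣S+K+r+1 : 2 ∣ S + K + r + 1
      2∣S+K+r+1 = subst (2 ∣_) (sym (begin
        S + K + r + 1    ≡⟨ regroup S K r ⟩
        S + 1 + (K + r)  ≡⟨ cong (_+ (K + r)) (degree D x) ⟩
        r + v + (K + r)  ≡⟨ regroup′ r v K ⟩
        v + K + 2 * r    ∎))
        (∣m∣n⇒∣m+n (∣m∣n⇒∣m+n 2∣v 2∣K) (m∣m*n r))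
        where
        open ≡-Reasoning
        regroup : ∀ s k r → s + k + r + 1 ≡ s + 1 + (k + r)
        regroup = solve-∀
        regroup′ : ∀ r v k → r + v + (k + r) ≡ v + k + 2 * r
        regroup′ = solve-∀

    v≤β*4 : 2 ∣ v → v ≤ β D * 4
    v≤β*4 2∣v = begin
      v                                          ≡⟨ ∑-ones v ⟨
      ∑[ x < v ] 1                               ≤⟨ ∑-mono-≤ (λ x → ℕ.n≢0⇒n>0 (K4sThrough≢0 x)) ⟩
      ∑[ x < v ] K4sThrough x                    ≡⟨ double-count D isK4 ⟩
      ∑[ i < numBlocks D ] (size D i * isK4 i)   ≡⟨ ∑-by-size (λ n → n * 𝟙 (n ℕ.≟ 4)) (blocks D) only345 ⟩
      α D * 0 + β D * 4 + γ D * 0                ≡⟨ drop-zeros (α D) (β D) (γ D) ⟩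
      β D * 4                                    ∎
      where
      open ℕ.≤-Reasoning
      K4sThrough≢0 : ∀ x → K4sThrough x ≢ 0
      K4sThrough≢0 x K≡0 = K4sThrough-odd 2∣v x (subst (2 ∣_) (sym K≡0) (2 ∣0))
      drop-zeros : ∀ a b c → a * 0 + b * 4 + c * 0 ≡ b * 4
      drop-zeros = solve-∀

    edge-count : α D * 6 + β D * 12 + γ D * 20 + v ≡ v * v
    edge-count = ℕ.+-cancelˡ-≡ (α D * 3 + β D * 4 + γ D * 5) _ _ (begin
      α D * 3 + β D * 4 + γ D * 5 + (α D * 6 + β D * 12 + γ D * 20 + v)
        ≡⟨ regroup (α D) (β D) (γ D) v ⟩
      α D * 9 + β D * 16 + γ D * 25 + v
        ≡⟨ cong (_+ v) (∑-by-size (λ n → n * n) (blocks D) only345) ⟨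
      ∑[ i < numBlocks D ] (size D i * size D i) + v
        ≡⟨ ∑-size² D ⟩
      ∑[ i < numBlocks D ] size D i + v * v
        ≡⟨ cong (_+ v * v) (∑-by-size (λ n → n) (blocks D) only345) ⟩
      α D * 3 + β D * 4 + γ D * 5 + v * v
        ∎)
      where
      open ≡-Reasoning
      regroup : ∀ a b c v → a * 3 + b * 4 + c * 5 + (a * 6 + b * 12 + c * 20 + v)
                              ≡ a * 9 + b * 16 + c * 25 + v
      regroup = solve-∀

    20c≡14α+2[4β∸v]+v+v² : 2 ∣ v →
                           20 * (α D + β D + γ D) ≡ α D * 14 + 2 * (β D * 4 ∸ v) + v + v * v
    20c≡14α+2[4β∸v]+v+v² 2∣v = ℕ.+-cancelʳ-≡ v _ _ (begin
      20 * (α D + β D + γ D) + v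
        ≡⟨ regroup (α D) (β D) (γ D) v ⟩
      α D * 14 + 2 * (β D * 4) + (α D * 6 + β D * 12 + γ D * 20 + v)
        ≡⟨ cong₂ (λ p q → α D * 14 + 2 * p + q) (sym (ℕ.m+[n∸m]≡n (v≤β*4 2∣v))) edge-count ⟩
      α D * 14 + 2 * (v + d) + v * v
        ≡⟨ regroup′ (α D) v d ⟩
      α D * 14 + 2 * d + v + v * v + v
        ∎)
      where
      open ≡-Reasoning
      d : ℕ
      d = β D * 4 ∸ v
      regroup : ∀ a b c v → 20 * (a + b + c) + v
                              ≡ a * 14 + 2 * (b * 4) + (a * 6 + b * 12 + c * 20 + v)
      regroup = solve-∀
      regroup′ : ∀ a v d → a * 14 + 2 * (v + d) + v * v ≡ a * 14 + 2 * d + v + v * v + v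
      regroup′ = solve-∀

open import Data.Integer using (ℤ; +_; _-_; _*_)
open import Data.Integer.DivMod using (_/_)
import Data.Integer as Int

import Data.Nat as ℕ
import Data.Nat.Properties as ℕ
import Data.Nat.DivMod as ℕ
import Data.Integer.Properties as Int
open import Data.Integer.DivMod using (div-pos-is-/ℕ)
open import Data.Nat.Divisibility using (divides; ∣-trans; m%n≡0⇒n∣m)
open import Relation.Binary.PropositionalEquality using (refl; sym; cong; cong₂; module ≡-Reasoning)
open Counting using (α; β; γ; 20c≡14α+2[4β∸v]+v+v²)

+[m+n]-+n≡+m : ∀ m n → + (m ℕ.+ n) - + n ≡ + m
+[m+n]-+n≡+m m n = begin
  + (m ℕ.+ n) - + n      ≡⟨ Int.[+m]-[+n]≡m⊖n (m ℕ.+ n) n ⟩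
  (m ℕ.+ n) Int.⊖ n      ≡⟨ Int.⊖-≥ (ℕ.m≤n+m n m) ⟩
  + (m ℕ.+ n ℕ.∸ n)      ≡⟨ cong +_ (ℕ.m+n∸n≡m m n) ⟩
  + m                    ∎
  where open ≡-Reasoning

20c-v²-v≡n : ∀ {c v n} → 20 ℕ.* c ≡ n ℕ.+ v ℕ.+ v ℕ.* v → + 20 * + c - + v * + v - + v ≡ + n
20c-v²-v≡n {c} {v} {n} 20c≡n+v+v² = begin
  + 20 * + c - + v * + v - + v                  ≡⟨ cong₂ (λ p q → p - q - + v) (Int.pos-* 20 c) (Int.pos-* v v) ⟨
  + (20 ℕ.* c) - + (v ℕ.* v) - + v              ≡⟨ cong (λ m → + m - + (v ℕ.* v) - + v) 20c≡n+v+v² ⟩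
  + (n ℕ.+ v ℕ.+ v ℕ.* v) - + (v ℕ.* v) - + v   ≡⟨ cong (_- + v) (+[m+n]-+n≡+m (n ℕ.+ v) (v ℕ.* v)) ⟩
  + (n ℕ.+ v) - + v                             ≡⟨ +[m+n]-+n≡+m n v ⟩
  + n                                           ∎
  where open ≡-Reasoning

m≤[m*n+o]/n : ∀ m n o .{{_ : ℕ.NonZero n}} → m ℕ.≤ (m ℕ.* n ℕ.+ o) ℕ./ n
m≤[m*n+o]/n m n o =
  ℕ.≤-trans (ℕ.≤-reflexive (sym (ℕ.m*n/n≡m m n))) (ℕ./-monoˡ-≤ n (ℕ.m≤m+n (m ℕ.* n) o))

floor-bound : ∀ {a c v n} → 20 ℕ.* c ≡ a ℕ.* 14 ℕ.+ n ℕ.+ v ℕ.+ v ℕ.* v →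
              + a Int.≤ (+ 20 * + c - + v * + v - + v) / + 14
floor-bound {a} {c} {v} {n} 20c≡14a+n+v+v² = begin
  + a                                    ≤⟨ Int.+≤+ (m≤[m*n+o]/n a 14 n) ⟩
  + ((a ℕ.* 14 ℕ.+ n) ℕ./ 14)            ≡⟨ div-pos-is-/ℕ (+ (a ℕ.* 14 ℕ.+ n)) 14 ⟨
  + (a ℕ.* 14 ℕ.+ n) / + 14              ≡⟨ cong (_/ + 14) (20c-v²-v≡n {c} {v} 20c≡14a+n+v+v²) ⟨
  (+ 20 * + c - + v * + v - + v) / + 14  ∎
  where open Int.≤-Reasoning

lemma45 : ∀ (v : ℕ) → v % 4 ≡ 0 → (D : CliqueDecomposition v) → Only345 D →
    let α = numBlocksOfSize D 3
        β = numBlocksOfSize D 4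
        γ = numBlocksOfSize D 5
        c = α Data.Nat.+ β Data.Nat.+ γ
    in (+ α) Int.≤ ((+ 20 * + c - + v * + v - + v) / + 14)
lemma45 v v%4≡0 D only345 =
  floor-bound {c = α D ℕ.+ β D ℕ.+ γ D}
    (20c≡14α+2[4β∸v]+v+v² D only345 (∣-trans (divides 2 refl) (m%n≡0⇒n∣m v 4 v%4≡0)))
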